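{- Let $n\ge5$ be an odd integer, $T=\langle 2,n\rangle$, $d\ge1$, and let $S=\{\mathbf{a}\in\mathbb{N}^d:|\mathbf{a}|\in T\}$ be the $T$-graded GNS. Then $S$ satisfies the generalized Wilf's conjecture, i.e. $\operatorname{e}(S)\operatorname{n}(S)\ge d\operatorname{c}(S)$ (equivalently $(\operatorname{e}(S)-d)\operatorname{n}(S)\ge d\operatorname{g}(S)$).
   Context: $\mathbb{N}$ is the set of non-negative integers; $|\mathbf{x}|$ is the sum of coordinates; $\le$ is the componentwise order. For a GNS $S\subseteq\mathbb{N}^d$ (submonoid with finite complement $\operatorname{H}(S)=\mathbb{N}^d\setminus S$): $\operatorname{g}(S)=|\operatorname{H}(S)|$; $\operatorname{e}(S)$ is the cardinality of the minimal system of generators; $\operatorname{n}(S)=|\{\mathbf{s}\in S:\mathbf{s}\le\mathbf{h}\text{ for some }\mathbf{h}\in\operatorname{H}(S)\}|$; $\operatorname{c}(S)=|\{\mathbf{x}\in\mathbb{N}^d:\mathbf{x}\le\mathbf{h}\text{ for some }\mathbf{h}\in\operatorname{H}(S)\}|$. -}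

module Defs where

open import Data.Nat using (ℕ; _+_; _*_; _≤_)
open import Data.Vec using (Vec; replicate; zipWith; sum)
open import Data.Vec.Relation.Binary.Pointwise.Inductive using (Pointwise)
open import Data.List using (List; length)
open import Data.List.Membership.Propositional using (_∈_)
open import Data.List.Relation.Unary.Unique.Propositional using (Unique)
open import Data.Product using (Σ; ∃; _×_)
open import Relation.Nullary using (¬_)
open import Relation.Binary.PropositionalEquality using (_≡_; _≢_)

𝟎 : ∀ {d} → Vec ℕ d
𝟎 = replicate _ 0

_⊕_ : ∀ {d} → Vec ℕ d → Vec ℕ d → Vec ℕ d
_⊕_ = zipWith _+_

_≤ᵥ_ : ∀ {d} → Vec ℕ d → Vec ℕ d → Set
_≤ᵥ_ = Pointwise _≤_

∣_∣ᵥ : ∀ {d} → Vec ℕ d → ℕ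
∣ x ∣ᵥ = sum x

In⟨2,_⟩ : ℕ → ℕ → Set
In⟨2, n ⟩ x = ∃ λ a → ∃ λ b → x ≡ 2 * a + n * b

GradedS : ℕ → (d : ℕ) → Vec ℕ d → Set
GradedS n d a = In⟨2, n ⟩ ∣ a ∣ᵥ

module _ {d : ℕ} (S : Vec ℕ d → Set) where
  MinGen : Vec ℕ d → Set
  MinGen x = S x × x ≢ 𝟎 ×
    ¬ (∃ λ y → ∃ λ z → S y × S z × y ≢ 𝟎 × z ≢ 𝟎 × x ≡ y ⊕ z)

  Hole : Vec ℕ d → Set
  Hole x = ¬ S x

  -- elements of S below some hole (counted by n(S))
  SmallElt : Vec ℕ d → Set
  SmallElt x = S x × ∃ λ h → Hole h × x ≤ᵥ h

  -- points of ℕ^d below some hole (counted by c(S))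
  BelowHole : Vec ℕ d → Set
  BelowHole x = ∃ λ h → Hole h × x ≤ᵥ h

HasCard : ∀ {d} → (Vec ℕ d → Set) → ℕ → Set
HasCard {d} P k = Σ (List (Vec ℕ d)) λ l →
  Unique l × (∀ x → (x ∈ l → P x) × (P x → x ∈ l)) × length l ≡ k

{-# OPTIONS --safe #-}
module Submission where

-- Every pair (i, x) of a coordinate and a point below a hole is decoded from a minimal generator g
-- and an element y ∈ S below a hole, as i = first coordinate of g that is ≥ 2 and x = y + (g mod 2).
-- If |x| is even take g = 2eᵢ and y = x; if |x| is odd, write x = y + eⱼ and take g = (n − 1)eᵢ + eⱼ.
-- In both cases |g| is an atom of ⟨2, n⟩ (2, resp. n), so g is a minimal generator of S, and |y| is
-- even, so y ∈ S. Counting pairs gives d·c(S) ≤ e(S)·n(S).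

open import Defs
open import Algebra.Properties.CommutativeSemigroup using (interchange)
open import Data.Bool using (if_then_else_)
open import Data.Empty using (⊥-elim)
open import Data.Fin using (Fin; zero; suc)
open import Data.List using (List; []; _∷_; length; map; cartesianProduct; allFin; _++_)
open import Data.List.Membership.Propositional using (_∈_)
open import Data.List.Membership.Propositional.Properties
  using (∈-map⁺; ∈-map⁻; ∈-cartesianProduct⁺; ∈-cartesianProduct⁻)
open import Data.List.Properties using (length-map; length-++; length-tabulate; length-removeAt′)
open import Data.List.Relation.Unary.All using () renaming (lookup to lookupᴬ)
open import Data.List.Relation.Unary.AllPairs using (_∷_)
open import Data.List.Relation.Unary.Any using (here; there; index; _─_)
open import Data.List.Relation.Unary.Unique.Propositional using (Unique)
open import Data.List.Relation.Unary.Unique.Propositional.Properties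
  using (cartesianProduct⁺; allFin⁺) renaming (map⁺ to Unique-map⁺)
open import Data.Maybe using (Maybe; just; nothing)
open import Data.Maybe.Properties using (just-injective)
import Data.Maybe as Maybe
open import Data.Nat using (ℕ; zero; suc; _+_; _*_; _≤_; _<_; _≤ᵇ_; _%_; _/_; z≤n; s≤s)
open import Data.Nat.DivMod using (m≡m%n+[m/n]*n; [m+kn]%n≡m%n; m<n⇒m%n≡m; m%n<n; m≥n⇒m/n>0)
open import Data.Nat.Properties
open import Data.Product using (∃; ∃₂; _×_; _,_; proj₁; proj₂)
open import Data.Sum using (_⊎_; inj₁; inj₂)
open import Data.Vec using (Vec; []; _∷_; sum)
import Data.Vec as Vec
open import Data.Vec.Properties using (zipWith-identityˡ; zipWith-identityʳ)
open import Data.Vec.Relation.Binary.Pointwise.Inductive using ([]; _∷_)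
import Data.Vec.Relation.Binary.Pointwise.Inductive as Pointwise
open import Data.Vec.Relation.Unary.All using (All; []; _∷_)
open import Function using (_∘_)
open import Relation.Binary.PropositionalEquality
open import Relation.Nullary using (¬_)

module _ {A : Set} where

  ∈-─ : ∀ {x y : A} {ys} (y∈ys : y ∈ ys) → x ∈ ys → y ≢ x → x ∈ (ys ─ y∈ys)
  ∈-─ (here refl) (here refl)  y≢x = ⊥-elim (y≢x refl)
  ∈-─ (here _)    (there x∈ys) _   = x∈ys
  ∈-─ (there _)   (here x≡z)   _   = here x≡z
  ∈-─ (there y∈ys) (there x∈ys) y≢x = there (∈-─ y∈ys x∈ys y≢x)

  Unique-⊆⇒length≤ : ∀ {xs ys : List A} → Unique xs → (∀ {x} → x ∈ xs → x ∈ ys) →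
                     length xs ≤ length ys
  Unique-⊆⇒length≤ {[]}     _              _     = z≤n
  Unique-⊆⇒length≤ {x ∷ xs} {ys} (x∉xs ∷ xs!) xs⊆ys = begin
      suc (length xs)          ≤⟨ s≤s (Unique-⊆⇒length≤ xs! xs⊆ys─x) ⟩
      suc (length (ys ─ x∈ys)) ≡⟨ length-removeAt′ ys (index x∈ys) ⟨
      length ys                ∎
    where
    open ≤-Reasoning
    x∈ys : x ∈ ys
    x∈ys = xs⊆ys (here refl)
    xs⊆ys─x : ∀ {z} → z ∈ xs → z ∈ (ys ─ x∈ys)
    xs⊆ys─x z∈xs = ∈-─ x∈ys (xs⊆ys (there z∈xs)) (lookupᴬ x∉xs z∈xs)

length-cartesianProduct : ∀ {A B : Set} (xs : List A) (ys : List B) →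
                          length (cartesianProduct xs ys) ≡ length xs * length ys
length-cartesianProduct []       ys = refl
length-cartesianProduct (x ∷ xs) ys = begin
  length (map (x ,_) ys ++ cartesianProduct xs ys)
    ≡⟨ length-++ (map (x ,_) ys) ⟩
  length (map (x ,_) ys) + length (cartesianProduct xs ys)
    ≡⟨ cong₂ _+_ (length-map (x ,_) ys) (length-cartesianProduct xs ys) ⟩
  length ys + length xs * length ys
    ∎
  where open ≡-Reasoning

module _ {A B C : Set} where

  Unique⊆image⇒length≤ : ∀ {zs : List C} (f : A × B → C) (xs : List A) (ys : List B) →
    Unique zs → (∀ {z} → z ∈ zs → ∃₂ λ x y → x ∈ xs × y ∈ ys × f (x , y) ≡ z) →
    length zs ≤ length xs * length ys
  Unique⊆image⇒length≤ {zs} f xs ys zs! covered = begin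
    length zs                               ≤⟨ Unique-⊆⇒length≤ zs! zs⊆image ⟩
    length (map f (cartesianProduct xs ys)) ≡⟨ length-map f (cartesianProduct xs ys) ⟩
    length (cartesianProduct xs ys)         ≡⟨ length-cartesianProduct xs ys ⟩
    length xs * length ys                   ∎
    where
    open ≤-Reasoning
    zs⊆image : ∀ {z} → z ∈ zs → z ∈ map f (cartesianProduct xs ys)
    zs⊆image z∈zs with covered z∈zs
    ... | x , y , x∈xs , y∈ys , refl = ∈-map⁺ f (∈-cartesianProduct⁺ x∈xs y∈ys)

card-≤-covering : ∀ {d} {P Q R : Vec ℕ d → Set} {p q r}
  (f : Vec ℕ d × Vec ℕ d → Maybe (Fin d) × Vec ℕ d) →
  (∀ i {x} → R x → ∃₂ λ g y → P g × Q y × f (g , y) ≡ (just i , x)) →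
  HasCard P p → HasCard Q q → HasCard R r → d * r ≤ p * q
card-≤-covering {d} f cover (Ps , _ , P⇔ , refl) (Qs , _ , Q⇔ , refl) (Rs , Rs! , R⇔ , refl) =
  subst (_≤ length Ps * length Qs) |Is×Rs|
    (Unique⊆image⇒length≤ f Ps Qs (cartesianProduct⁺ Is! Rs!) Is×Rs⊆image)
  where
  Is : List (Maybe (Fin d))
  Is = map just (allFin d)
  Is! : Unique Is
  Is! = Unique-map⁺ just-injective (allFin⁺ d)
  |Is| : length Is ≡ d
  |Is| = trans (length-map just (allFin d)) (length-tabulate {n = d} (λ i → i))
  |Is×Rs| : length (cartesianProduct Is Rs) ≡ d * length Rs
  |Is×Rs| = trans (length-cartesianProduct Is Rs) (cong (_* length Rs) |Is|)
  Is×Rs⊆image : ∀ {z} → z ∈ cartesianProduct Is Rs → ∃₂ λ g y → g ∈ Ps × y ∈ Qs × f (g , y) ≡ z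
  Is×Rs⊆image z∈Is×Rs with ∈-cartesianProduct⁻ Is Rs z∈Is×Rs
  ... | just-i∈Is , x∈Rs with ∈-map⁻ just just-i∈Is
  ... | i , _ , refl with cover i (proj₁ (R⇔ _) x∈Rs)
  ... | g , y , Pg , Qy , f[g,y]≡[i,x] =
    g , y , proj₂ (P⇔ g) Pg , proj₂ (Q⇔ y) Qy , f[g,y]≡[i,x]

_·𝐞_ : ∀ {d} → ℕ → Fin d → Vec ℕ d
c ·𝐞 zero  = c ∷ 𝟎
c ·𝐞 suc i = 0 ∷ c ·𝐞 i

⊕-identityˡ : ∀ {d} (x : Vec ℕ d) → 𝟎 ⊕ x ≡ x
⊕-identityˡ = zipWith-identityˡ +-identityˡ

⊕-identityʳ : ∀ {d} (x : Vec ℕ d) → x ⊕ 𝟎 ≡ x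
⊕-identityʳ = zipWith-identityʳ +-identityʳ

x≤ᵥx⊕y : ∀ {d} (x y : Vec ℕ d) → x ≤ᵥ (x ⊕ y)
x≤ᵥx⊕y []      []      = []
x≤ᵥx⊕y (a ∷ x) (b ∷ y) = m≤m+n a b ∷ x≤ᵥx⊕y x y

sum-⊕ : ∀ {d} (x y : Vec ℕ d) → ∣ x ⊕ y ∣ᵥ ≡ ∣ x ∣ᵥ + ∣ y ∣ᵥ
sum-⊕ []      []      = refl
sum-⊕ (a ∷ x) (b ∷ y) = begin
  a + b + ∣ x ⊕ y ∣ᵥ       ≡⟨ cong (a + b +_) (sum-⊕ x y) ⟩
  a + b + (∣ x ∣ᵥ + ∣ y ∣ᵥ) ≡⟨ interchange +-commutativeSemigroup a b ∣ x ∣ᵥ ∣ y ∣ᵥ ⟩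
  a + ∣ x ∣ᵥ + (b + ∣ y ∣ᵥ) ∎
  where open ≡-Reasoning

sum-𝟎 : ∀ {d} → ∣ 𝟎 {d} ∣ᵥ ≡ 0
sum-𝟎 {zero}  = refl
sum-𝟎 {suc d} = sum-𝟎 {d}

sum-·𝐞 : ∀ {d} c (i : Fin d) → ∣ c ·𝐞 i ∣ᵥ ≡ c
sum-·𝐞 {suc d} c zero    = trans (cong (c +_) (sum-𝟎 {d})) (+-identityʳ c)
sum-·𝐞         c (suc i) = sum-·𝐞 c i

sum≡0⇒≡𝟎 : ∀ {d} (x : Vec ℕ d) → ∣ x ∣ᵥ ≡ 0 → x ≡ 𝟎
sum≡0⇒≡𝟎 []         _     = refl
sum≡0⇒≡𝟎 (zero ∷ x) ∣x∣≡0 = cong (0 ∷_) (sum≡0⇒≡𝟎 x ∣x∣≡0)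

split-·𝐞 : ∀ {d} (x : Vec ℕ d) → 1 ≤ ∣ x ∣ᵥ → ∃₂ λ j y → x ≡ y ⊕ (1 ·𝐞 j)
split-·𝐞 (zero ∷ x) 1≤∣x∣ with split-·𝐞 x 1≤∣x∣
... | j , y , refl = suc j , 0 ∷ y , refl
split-·𝐞 (suc a ∷ x) _ = zero , a ∷ x , cong₂ _∷_ (+-comm 1 a) (sym (⊕-identityʳ x))

even-or-odd : ∀ m → (∃ λ k → m ≡ 2 * k) ⊎ (∃ λ k → m ≡ 1 + 2 * k)
even-or-odd m with m % 2 | m≡m%n+[m/n]*n m 2 | m%n<n m 2
... | 0           | m≡[m/2]*2   | _ = inj₁ (m / 2 , trans m≡[m/2]*2 (*-comm (m / 2) 2))
... | 1           | m≡1+[m/2]*2 | _ = inj₂ (m / 2 , trans m≡1+[m/2]*2 (cong suc (*-comm (m / 2) 2)))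
... | suc (suc _) | _           | s≤s (s≤s ())

%2≡1⇒odd : ∀ m → m % 2 ≡ 1 → m ≡ 1 + 2 * (m / 2)
%2≡1⇒odd m m%2≡1 = trans (m≡m%n+[m/n]*n m 2) (cong₂ _+_ m%2≡1 (*-comm (m / 2) 2))

[2k+b]%2≡b : ∀ k {b} → b ≤ 1 → (2 * k + b) % 2 ≡ b
[2k+b]%2≡b k {b} b≤1 = begin
  (2 * k + b) % 2 ≡⟨ cong (_% 2) (trans (+-comm (2 * k) b) (cong (b +_) (*-comm 2 k))) ⟩
  (b + k * 2) % 2 ≡⟨ [m+kn]%n≡m%n b k 2 ⟩
  b % 2           ≡⟨ m<n⇒m%n≡m (s≤s b≤1) ⟩
  b               ∎
  where open ≡-Reasoning

ZeroOne : ∀ {d} → Vec ℕ d → Set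
ZeroOne = All (_≤ 1)

zeroOne-𝟎 : ∀ {d} → ZeroOne (𝟎 {d})
zeroOne-𝟎 {zero}  = []
zeroOne-𝟎 {suc d} = z≤n ∷ zeroOne-𝟎

zeroOne-·𝐞 : ∀ {d} {b} (j : Fin d) → b ≤ 1 → ZeroOne (b ·𝐞 j)
zeroOne-·𝐞 zero    b≤1 = b≤1 ∷ zeroOne-𝟎
zeroOne-·𝐞 (suc j) b≤1 = z≤n ∷ zeroOne-·𝐞 j b≤1

first≥2 : ∀ {d} → Vec ℕ d → Maybe (Fin d)
first≥2 []       = nothing
first≥2 (v ∷ vs) = if 2 ≤ᵇ v then just zero else Maybe.map suc (first≥2 vs)

first≥2-·𝐞⊕ : ∀ {d} {c} (i : Fin d) (w : Vec ℕ d) → 2 ≤ c → ZeroOne w →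
              first≥2 ((c ·𝐞 i) ⊕ w) ≡ just i
first≥2-·𝐞⊕ zero    (_ ∷ _)           (s≤s (s≤s _)) _ = refl
first≥2-·𝐞⊕ (suc i) (0 ∷ w)           2≤c (_ ∷ 01w) = cong (Maybe.map suc) (first≥2-·𝐞⊕ i w 2≤c 01w)
first≥2-·𝐞⊕ (suc i) (1 ∷ w)           2≤c (_ ∷ 01w) = cong (Maybe.map suc) (first≥2-·𝐞⊕ i w 2≤c 01w)
first≥2-·𝐞⊕ (suc i) (suc (suc _) ∷ _) _   (s≤s () ∷ _)

parities : ∀ {d} → Vec ℕ d → Vec ℕ d
parities = Vec.map (_% 2)

parities-zeroOne : ∀ {d} {w : Vec ℕ d} → ZeroOne w → parities w ≡ w
parities-zeroOne []          = refl
parities-zeroOne (b≤1 ∷ 01w) = cong₂ _∷_ ([2k+b]%2≡b 0 b≤1) (parities-zeroOne 01w)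

parities-·𝐞⊕ : ∀ {d} k (i : Fin d) {w : Vec ℕ d} → ZeroOne w →
               parities (((2 * k) ·𝐞 i) ⊕ w) ≡ w
parities-·𝐞⊕ k zero    {_ ∷ w} (b≤1 ∷ 01w) =
  cong₂ _∷_ ([2k+b]%2≡b k b≤1) (trans (cong parities (⊕-identityˡ w)) (parities-zeroOne 01w))
parities-·𝐞⊕ k (suc i) (b≤1 ∷ 01w) = cong₂ _∷_ ([2k+b]%2≡b 0 b≤1) (parities-·𝐞⊕ k i 01w)

decode : ∀ {d} → Vec ℕ d × Vec ℕ d → Maybe (Fin d) × Vec ℕ d
decode (g , y) = first≥2 g , y ⊕ parities g

decode-·𝐞⊕ : ∀ {d} k (i : Fin d) (w y : Vec ℕ d) → 1 ≤ k → ZeroOne w →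
             decode (((2 * k) ·𝐞 i) ⊕ w , y) ≡ (just i , y ⊕ w)
decode-·𝐞⊕ k i w y 1≤k 01w =
  cong₂ _,_ (first≥2-·𝐞⊕ i w (*-monoʳ-≤ 2 1≤k) 01w) (cong (y ⊕_) (parities-·𝐞⊕ k i 01w))

Atom : (ℕ → Set) → ℕ → Set
Atom T m = T m × m ≢ 0 × ¬ (∃₂ λ a b → T a × T b × a ≢ 0 × b ≢ 0 × m ≡ a + b)

Covered : ∀ {d} → (Vec ℕ d → Set) → Fin d → Vec ℕ d → Set
Covered S i x = ∃₂ λ g y → MinGen S g × SmallElt S y × decode (g , y) ≡ (just i , x)

module _ {T : ℕ → Set} {d : ℕ} where

  private
    S : Vec ℕ d → Set
    S a = T ∣ a ∣ᵥ

  atom⇒MinGen : ∀ {g} → Atom T ∣ g ∣ᵥ → MinGen S g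
  atom⇒MinGen {g} (T∣g∣ , ∣g∣≢0 , indecomposable) = T∣g∣ , g≢𝟎 , g-indecomposable
    where
    g≢𝟎 : g ≢ 𝟎
    g≢𝟎 refl = ∣g∣≢0 (sum-𝟎 {d})
    g-indecomposable : ¬ (∃₂ λ y z → S y × S z × y ≢ 𝟎 × z ≢ 𝟎 × g ≡ y ⊕ z)
    g-indecomposable (y , z , Sy , Sz , y≢𝟎 , z≢𝟎 , refl) =
      indecomposable
        (∣ y ∣ᵥ , ∣ z ∣ᵥ , Sy , Sz , y≢𝟎 ∘ sum≡0⇒≡𝟎 y , z≢𝟎 ∘ sum≡0⇒≡𝟎 z , sum-⊕ y z)

  covered : ∀ k (i : Fin d) {w y h m} → 1 ≤ k → ZeroOne w → 2 * k + ∣ w ∣ᵥ ≡ m → Atom T m →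
            S y → Hole S h → (y ⊕ w) ≤ᵥ h → Covered S i (y ⊕ w)
  covered k i {w} {y} {h} 1≤k 01w ∣g∣≡m atom Sy hole y⊕w≤h =
    g , y , atom⇒MinGen (subst (Atom T) (sym (trans ∣g∣ ∣g∣≡m)) atom) , (Sy , h , hole , y≤h) ,
    decode-·𝐞⊕ k i w y 1≤k 01w
    where
    g : Vec ℕ d
    g = ((2 * k) ·𝐞 i) ⊕ w
    ∣g∣ : ∣ g ∣ᵥ ≡ 2 * k + ∣ w ∣ᵥ
    ∣g∣ = trans (sum-⊕ ((2 * k) ·𝐞 i) w) (cong (_+ ∣ w ∣ᵥ) (sum-·𝐞 (2 * k) i))
    y≤h : y ≤ᵥ h
    y≤h = Pointwise.trans ≤-trans (x≤ᵥx⊕y y w) y⊕w≤h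

module _ {n : ℕ} where

  In⟨2,n⟩-even : ∀ k → In⟨2, n ⟩ (2 * k)
  In⟨2,n⟩-even k = k , 0 , sym (trans (cong (2 * k +_) (*-zeroʳ n)) (+-identityʳ (2 * k)))

  In⟨2,n⟩-≢0⇒≥2 : 2 ≤ n → ∀ {m} → In⟨2, n ⟩ m → m ≢ 0 → 2 ≤ m
  In⟨2,n⟩-≢0⇒≥2 _   (zero  , zero  , m≡0) m≢0 = ⊥-elim (m≢0 (trans m≡0 (*-zeroʳ n)))
  In⟨2,n⟩-≢0⇒≥2 _   (suc a , b     , refl) _ =
    ≤-trans (*-monoʳ-≤ 2 (s≤s z≤n)) (m≤m+n (2 * suc a) (n * b))
  In⟨2,n⟩-≢0⇒≥2 2≤n (zero  , suc b , refl) _ = ≤-trans 2≤n (m≤m*n n (suc b))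

  In⟨2,n⟩-<n⇒even : ∀ {m} → In⟨2, n ⟩ m → m < n → ∃ λ a → m ≡ 2 * a
  In⟨2,n⟩-<n⇒even (a , zero  , refl) _   = a , trans (cong (2 * a +_) (*-zeroʳ n)) (+-identityʳ (2 * a))
  In⟨2,n⟩-<n⇒even (a , suc b , refl) m<n =
    ⊥-elim (<⇒≱ m<n (≤-trans (m≤m*n n (suc b)) (m≤n+m (n * suc b) (2 * a))))

  atom-2 : 2 ≤ n → Atom In⟨2, n ⟩ 2
  atom-2 2≤n = In⟨2,n⟩-even 1 , (λ ()) , indecomposable
    where
    indecomposable : ¬ (∃₂ λ a b → In⟨2, n ⟩ a × In⟨2, n ⟩ b × a ≢ 0 × b ≢ 0 × 2 ≡ a + b)
    indecomposable (a , b , Ta , Tb , a≢0 , b≢0 , 2≡a+b) =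
      4≰2 (subst (4 ≤_) (sym 2≡a+b)
        (+-mono-≤ (In⟨2,n⟩-≢0⇒≥2 2≤n Ta a≢0) (In⟨2,n⟩-≢0⇒≥2 2≤n Tb b≢0)))
      where
      4≰2 : ¬ (4 ≤ 2)
      4≰2 (s≤s (s≤s ()))

module _ {n q : ℕ} (n≡1+2q : n ≡ 1 + 2 * q) (1≤q : 1 ≤ q) where

  private
    2≤n : 2 ≤ n
    2≤n = subst (2 ≤_) (sym n≡1+2q) (s≤s (≤-trans 1≤q (m≤m+n q (q + 0))))

    summand<n : ∀ {a b} → In⟨2, n ⟩ b → b ≢ 0 → n ≡ a + b → a < n
    summand<n {a} Tb b≢0 n≡a+b =
      subst (a <_) (sym n≡a+b) (m<m+n a (≤-trans (s≤s z≤n) (In⟨2,n⟩-≢0⇒≥2 2≤n Tb b≢0)))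

  atom-odd : Atom In⟨2, n ⟩ n
  atom-odd = (0 , 1 , sym (*-identityʳ n)) , n≢0 , indecomposable
    where
    n≢0 : n ≢ 0
    n≢0 n≡0 = 0≢1+n (trans (sym n≡0) n≡1+2q)
    indecomposable : ¬ (∃₂ λ a b → In⟨2, n ⟩ a × In⟨2, n ⟩ b × a ≢ 0 × b ≢ 0 × n ≡ a + b)
    indecomposable (a , b , Ta , Tb , a≢0 , b≢0 , n≡a+b)
      with In⟨2,n⟩-<n⇒even Ta (summand<n Tb b≢0 n≡a+b)
         | In⟨2,n⟩-<n⇒even Tb (summand<n Ta a≢0 (trans n≡a+b (+-comm a b)))
    ... | a′ , refl | b′ , refl = even≢odd (a′ + b′) q (begin
      2 * (a′ + b′)     ≡⟨ *-distribˡ-+ 2 a′ b′ ⟩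
      2 * a′ + 2 * b′   ≡⟨ n≡a+b ⟨
      n                 ≡⟨ n≡1+2q ⟩
      1 + 2 * q         ∎)
      where open ≡-Reasoning

  cover : ∀ {d} (i : Fin d) {x : Vec ℕ d} → BelowHole (GradedS n d) x → Covered (GradedS n d) i x
  cover {d} i {x} (h , hole , x≤h) with even-or-odd ∣ x ∣ᵥ
  ... | inj₁ (k , ∣x∣≡2k) =
    subst (Covered (GradedS n d) i) (⊕-identityʳ x)
      (covered 1 i ≤-refl zeroOne-𝟎 (cong (2 +_) (sum-𝟎 {d})) (atom-2 2≤n) Tx hole x⊕𝟎≤h)
    where
    Tx : In⟨2, n ⟩ ∣ x ∣ᵥ
    Tx = subst In⟨2, n ⟩ (sym ∣x∣≡2k) (In⟨2,n⟩-even {n} k)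
    x⊕𝟎≤h : (x ⊕ 𝟎) ≤ᵥ h
    x⊕𝟎≤h = subst (_≤ᵥ h) (sym (⊕-identityʳ x)) x≤h
  ... | inj₂ (k , ∣x∣≡1+2k) with split-·𝐞 x (subst (1 ≤_) (sym ∣x∣≡1+2k) (s≤s z≤n))
  ... | j , y , refl = covered q i 1≤q (zeroOne-·𝐞 j ≤-refl) ∣g∣≡n atom-odd Ty hole x≤h
    where
    open ≡-Reasoning
    ∣y∣≡2k : ∣ y ∣ᵥ ≡ 2 * k
    ∣y∣≡2k = +-cancelʳ-≡ 1 ∣ y ∣ᵥ (2 * k) (begin
      ∣ y ∣ᵥ + 1              ≡⟨ cong (∣ y ∣ᵥ +_) (sum-·𝐞 1 j) ⟨
      ∣ y ∣ᵥ + ∣ 1 ·𝐞 j ∣ᵥ     ≡⟨ sum-⊕ y (1 ·𝐞 j) ⟨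
      ∣ y ⊕ (1 ·𝐞 j) ∣ᵥ        ≡⟨ ∣x∣≡1+2k ⟩
      1 + 2 * k               ≡⟨ +-comm 1 (2 * k) ⟩
      2 * k + 1               ∎)
    Ty : In⟨2, n ⟩ ∣ y ∣ᵥ
    Ty = subst In⟨2, n ⟩ (sym ∣y∣≡2k) (In⟨2,n⟩-even {n} k)
    ∣g∣≡n : 2 * q + ∣ 1 ·𝐞 j ∣ᵥ ≡ n
    ∣g∣≡n = trans (cong (2 * q +_) (sum-·𝐞 1 j)) (trans (+-comm (2 * q) 1) (sym n≡1+2q))

proposition4p8 : (n : ℕ) → 5 ≤ n → n % 2 ≡ 1 → (d : ℕ) → 1 ≤ d →
    (e nS cS : ℕ) →
    HasCard (MinGen (GradedS n d)) e →
    HasCard (SmallElt (GradedS n d)) nS →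
    HasCard (BelowHole (GradedS n d)) cS →
    d * cS ≤ e * nS
proposition4p8 n 5≤n n%2≡1 d _ e nS cS =
  card-≤-covering decode (cover (%2≡1⇒odd n n%2≡1) (m≥n⇒m/n>0 (≤-trans (s≤s (s≤s z≤n)) 5≤n)))
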